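{- Let $G$ be a graph and let $V_1,V_2,\ldots,V_k$ be independent sets of $G$ such that for all $i\neq j$, either $V_i\cap V_j=\emptyset$ or $V_i=V_j$. Then the set $$V_1V_2\cdots V_k=\{\{x_1,x_2,\ldots,x_k\} : x_i\in V_i \text{ for all } i,\ x_i\neq x_j \text{ for all } i\neq j\}$$ is an independent set of $T_k(G)$.
   Context: All graphs are finite and simple. For a graph $G$ with vertex set $V$ of size $n$ and $1\le k\le n-1$, the $k$-token graph $T_k(G)$ has as vertices the $k$-subsets of $V$, two of them adjacent if their symmetric difference is an edge of $G$. An independent set is a set of pairwise non-adjacent vertices. -}

module Defs where

open import Level using (Level; 0ℓ; suc)
open import Data.Nat using (ℕ)
open import Data.Fin using (Fin)
open import Data.Fin.Subset using (Subset; _∈_; _∉_; ∣_∣)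
open import Data.Product using (Σ; ∃; _×_; _,_)
open import Data.Sum using (_⊎_)
open import Relation.Nullary using (¬_)
open import Relation.Binary.PropositionalEquality using (_≡_; _≢_)

record Graph (n : ℕ) : Set₁ where
  field
    E      : Fin n → Fin n → Set
    sym    : ∀ {x y} → E x y → E y x
    irrefl : ∀ {x} → ¬ E x x

open Graph public

IsIndependent : ∀ {n} → Graph n → Subset n → Set
IsIndependent G V = ∀ x y → x ∈ V → y ∈ V → ¬ E G x y

InSymDiff : ∀ {n} → Subset n → Subset n → Fin n → Set
InSymDiff S T x = (x ∈ S × x ∉ T) ⊎ (x ∉ S × x ∈ T)

TokenAdj : ∀ {n} → Graph n → Subset n → Subset n → Set
TokenAdj G S T = Σ _ λ a → Σ _ λ b → E G a b ×
  (∀ x → (InSymDiff S T x → (x ≡ a ⊎ x ≡ b)) × ((x ≡ a ⊎ x ≡ b) → InSymDiff S T x))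

-- a set P of vertices of T_k(G) (k-subsets of V(G)) that is independent in T_k(G)
IsIndependentInTokenGraph : ∀ {n} → Graph n → ℕ → (Subset n → Set) → Set
IsIndependentInTokenGraph G k P =
  (∀ S → P S → ∣ S ∣ ≡ k) × (∀ S T → P S → P T → ¬ TokenAdj G S T)

ProductSet : ∀ {n k} → (Fin k → Subset n) → Subset n → Set
ProductSet {n} {k} V S = Σ (Fin k → Fin n) λ x →
  (∀ i → x i ∈ V i) × (∀ i j → i ≢ j → x i ≢ x j) ×
  (∀ v → (v ∈ S → ∃ λ i → x i ≡ v) × ((∃ λ i → x i ≡ v) → v ∈ S))

Disjoint : ∀ {n} → Subset n → Subset n → Set
Disjoint V W = ∀ x → x ∈ V → x ∉ W

-- Suppose two members S = {x_1,…,x_k} and T = {y_1,…,y_k} of V_1⋯V_k were adjacent in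
-- T_k(G), with S ∖ T = {a}, T ∖ S = {b} and ab ∈ E(G); say a = x_i. If b ∈ V_i, the edge ab
-- would lie inside the independent set V_i. Otherwise consider the class C of indices l
-- with V_l = V_i. For l ∈ C the vertex y_l lies in V_i, so it is not b and hence belongs to
-- S, say y_l = x_σ(l); since the parts are disjoint or equal, σ(l) ∈ C. So σ is an injective
-- self-map of the finite class C, hence onto, and some y_l equals x_i = a ∉ T: a contradiction.
module Submission where

open import Defs hiding (sym)
open import Data.Nat using (ℕ; _≤_; _∸_; zero; suc)
open import Data.Nat.Properties using (n<1+n)
open import Data.Fin using (Fin; zero; suc; punchOut)
open import Data.Fin.Properties using (¬Fin0; any?; pigeonhole; punchOut-injective; <⇒≢; suc-injective) renaming (_≟_ to _≟ᶠ_)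
open import Data.Fin.Subset using (Subset; _∈_; _∉_; ∣_∣; _─_; _-_; inside; outside; ⁅_⁆)
open import Data.Fin.Subset.Properties using (_∈?_; p─⊥≡p; Empty-unique; ∣⊥∣≡0; p─q⊆p; x∈p∧x≢y⇒x∈p-y; x∉⁅y⁆⇒x≢y)
open import Data.Vec.Base using (_∷_; here; there)
open import Data.Vec.Properties using (≡-dec)
open import Data.Bool.Properties using () renaming (_≟_ to _≟ᵇ_)
open import Data.Sum using (_⊎_; inj₁; inj₂)
open import Data.Product using (∃; ∃₂; _×_; _,_; proj₁; proj₂)
open import Data.Empty using (⊥; ⊥-elim)
open import Relation.Nullary using (¬_; yes; no; contradiction)
open import Relation.Unary using (Pred; Decidable)
open import Relation.Binary.PropositionalEquality using (_≡_; _≢_; refl; sym; trans; cong; subst)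

Distinct : ∀ {m n} → (Fin m → Fin n) → Set
Distinct x = ∀ i j → i ≢ j → x i ≢ x j

Enumerates : ∀ {n k} → (Fin k → Fin n) → Subset n → Set
Enumerates x S = ∀ v → (v ∈ S → ∃ λ i → x i ≡ v) × ((∃ λ i → x i ≡ v) → v ∈ S)

DisjointOrEqual : ∀ {n k} → (Fin k → Subset n) → Set
DisjointOrEqual V = ∀ i j → i ≢ j → Disjoint (V i) (V j) ⊎ V i ≡ V j

x∈p─q⇒x∉q : ∀ {n} {p q : Subset n} {x} → x ∈ p ─ q → x ∉ q
x∈p─q⇒x∉q {p = _ ∷ _} {outside ∷ _} (there x∈p─q) (there x∈q) = x∈p─q⇒x∉q x∈p─q x∈q
x∈p─q⇒x∉q {p = _ ∷ _} {inside ∷ _}  (there x∈p─q) (there x∈q) = x∈p─q⇒x∉q x∈p─q x∈q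

x∈p-y⇒x≢y : ∀ {n} {p : Subset n} {x y} → x ∈ p - y → x ≢ y
x∈p-y⇒x≢y x∈p-y = x∉⁅y⁆⇒x≢y (x∈p─q⇒x∉q x∈p-y)

x∈p⇒∣p∣≡1+∣p-x∣ : ∀ {n} {p : Subset n} {x} → x ∈ p → ∣ p ∣ ≡ suc ∣ p - x ∣
x∈p⇒∣p∣≡1+∣p-x∣ {p = inside ∷ p}  here        = cong suc (cong ∣_∣ (sym (p─⊥≡p p)))
x∈p⇒∣p∣≡1+∣p-x∣ {p = inside ∷ _}  (there x∈p) = cong suc (x∈p⇒∣p∣≡1+∣p-x∣ x∈p)
x∈p⇒∣p∣≡1+∣p-x∣ {p = outside ∷ _} (there x∈p) = x∈p⇒∣p∣≡1+∣p-x∣ x∈p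

distinct-enumeration-size : ∀ {n} k {S : Subset n} (x : Fin k → Fin n) →
  Distinct x → Enumerates x S → ∣ S ∣ ≡ k
distinct-enumeration-size {n} zero {S} x _ x↠S =
  trans (cong ∣_∣ (Empty-unique λ (v , v∈S) → ¬Fin0 (proj₁ (proj₁ (x↠S v) v∈S)))) (∣⊥∣≡0 n)
distinct-enumeration-size (suc k) {S} x x-distinct x↠S =
  trans (x∈p⇒∣p∣≡1+∣p-x∣ x₀∈S)
        (cong suc (distinct-enumeration-size k (λ i → x (suc i)) tail-distinct tail↠S-x₀))
  where
  x₀∈S : x zero ∈ S
  x₀∈S = proj₂ (x↠S (x zero)) (zero , refl)

  tail-distinct : Distinct (λ i → x (suc i))
  tail-distinct i j i≢j = x-distinct (suc i) (suc j) (λ eq → i≢j (suc-injective eq))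

  tail↠S-x₀ : Enumerates (λ i → x (suc i)) (S - x zero)
  tail↠S-x₀ v = index , member
    where
    index : v ∈ S - x zero → ∃ λ i → x (suc i) ≡ v
    index v∈S-x₀ with proj₁ (x↠S v) (p─q⊆p S ⁅ x zero ⁆ v∈S-x₀)
    ... | zero  , x₀≡v = contradiction (sym x₀≡v) (x∈p-y⇒x≢y v∈S-x₀)
    ... | suc i , xᵢ≡v = i , xᵢ≡v
    member : (∃ λ i → x (suc i) ≡ v) → v ∈ S - x zero
    member (i , refl) = x∈p∧x≢y⇒x∈p-y (proj₂ (x↠S _) (suc i , refl)) (x-distinct (suc i) zero λ ())

-- If f missed i, punching i out of f would squeeze Fin (1 + k) into Fin k.
distinct⇒surjective : ∀ {k} (f : Fin k → Fin k) → Distinct f → ∀ i → ∃ λ l → f l ≡ i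
distinct⇒surjective {suc k} f f-distinct i with any? (λ l → f l ≟ᶠ i)
... | yes hit  = hit
... | no  miss with pigeonhole (n<1+n k) (λ l → punchOut {i = i} λ i≡fₗ → miss (l , sym i≡fₗ))
...   | l , l′ , l<l′ , collision =
  ⊥-elim (f-distinct l l′ (<⇒≢ l<l′) (punchOut-injective {i = i} _ _ collision))

-- The self-map is extended by the identity outside the class, which keeps it distinct.
class-self-map-surjective : ∀ {k ℓ} {C : Pred (Fin k) ℓ} → Decidable C →
  (σ : ∀ l → C l → Fin k) → (∀ l c → C (σ l c)) →
  (∀ l l′ c c′ → l ≢ l′ → σ l c ≢ σ l′ c′) →
  ∀ i → C i → ∃₂ λ l c → σ l c ≡ i
class-self-map-surjective {k} {C = C} C? σ σ-closed σ-distinct i cᵢ =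
  restrict (distinct⇒surjective extended extended-distinct i)
  where
  extended : Fin k → Fin k
  extended l with C? l
  ... | yes c = σ l c
  ... | no  _ = l

  extended-distinct : Distinct extended
  extended-distinct l l′ l≢l′ with C? l | C? l′
  ... | yes c  | yes c′ = σ-distinct l l′ c c′ l≢l′
  ... | yes c  | no ¬c′ = λ σₗ≡l′ → ¬c′ (subst C σₗ≡l′ (σ-closed l c))
  ... | no ¬c  | yes c′ = λ l≡σₗ′ → ¬c (subst C (sym l≡σₗ′) (σ-closed l′ c′))
  ... | no _   | no _   = l≢l′

  restrict : (∃ λ l → extended l ≡ i) → ∃₂ λ l c → σ l c ≡ i
  restrict (l , fₗ≡i) with C? l
  ... | yes c  = l , c , fₗ≡i
  ... | no  ¬c = ⊥-elim (¬c (subst C (sym fₗ≡i) cᵢ))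

common-element⇒≡ : ∀ {n k} {V : Fin k → Subset n} → DisjointOrEqual V →
  ∀ {i j v} → v ∈ V i → v ∈ V j → V i ≡ V j
common-element⇒≡ {V = V} V-parts {i} {j} {v} v∈Vᵢ v∈Vⱼ with i ≟ᶠ j
... | yes refl = refl
... | no i≢j with V-parts i j i≢j
...   | inj₁ disjoint = ⊥-elim (disjoint v v∈Vᵢ v∈Vⱼ)
...   | inj₂ Vᵢ≡Vⱼ    = Vᵢ≡Vⱼ

moved-token-stays-in-its-part : ∀ {n k} (V : Fin k → Subset n) → DisjointOrEqual V →
  ∀ {S T} {x y : Fin k → Fin n} →
  (∀ l → x l ∈ V l) → Enumerates x S →
  (∀ l → y l ∈ V l) → Distinct y → Enumerates y T →
  ∀ i {b} → x i ∉ T → (∀ v → v ∈ T → v ≢ b → v ∈ S) → b ∈ V i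
moved-token-stays-in-its-part V V-parts {S} {T} {x} {y} x∈V x↠S y∈V y-distinct y↠T i {b}
  xᵢ∉T T-b⊆S with b ∈? V i
... | yes b∈Vᵢ = b∈Vᵢ
... | no  b∉Vᵢ =
  ⊥-elim (xᵢ∉T (xᵢ∈T
    (class-self-map-surjective (λ l → ≡-dec _≟ᵇ_ (V l) (V i)) σ σ-closed σ-distinct i refl)))
  where
  SamePart : Fin _ → Set
  SamePart l = V l ≡ V i

  y∈T : ∀ l → y l ∈ T
  y∈T l = proj₂ (y↠T (y l)) (l , refl)

  y∈Vᵢ : ∀ l → SamePart l → y l ∈ V i
  y∈Vᵢ l c = subst (y l ∈_) c (y∈V l)

  y∈S : ∀ l → SamePart l → y l ∈ S
  y∈S l c = T-b⊆S (y l) (y∈T l) (λ yₗ≡b → b∉Vᵢ (subst (_∈ V i) yₗ≡b (y∈Vᵢ l c)))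

  σ : ∀ l → SamePart l → Fin _
  σ l c = proj₁ (proj₁ (x↠S (y l)) (y∈S l c))

  xσ≡y : ∀ l c → x (σ l c) ≡ y l
  xσ≡y l c = proj₂ (proj₁ (x↠S (y l)) (y∈S l c))

  σ-closed : ∀ l c → SamePart (σ l c)
  σ-closed l c = common-element⇒≡ V-parts (x∈V (σ l c)) (subst (_∈ V i) (sym (xσ≡y l c)) (y∈Vᵢ l c))

  σ-distinct : ∀ l l′ c c′ → l ≢ l′ → σ l c ≢ σ l′ c′
  σ-distinct l l′ c c′ l≢l′ σₗ≡σₗ′ =
    y-distinct l l′ l≢l′ (trans (sym (xσ≡y l c)) (trans (cong x σₗ≡σₗ′) (xσ≡y l′ c′)))

  xᵢ∈T : (∃₂ λ l c → σ l c ≡ i) → x i ∈ T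
  xᵢ∈T (l , c , σₗ≡i) = subst (_∈ T) (trans (sym (xσ≡y l c)) (cong x σₗ≡i)) (y∈T l)

¬move-along-edge : ∀ {n k} (G : Graph n) (V : Fin k → Subset n) →
  (∀ i → IsIndependent G (V i)) → DisjointOrEqual V →
  ∀ {S T} → ProductSet V S → ProductSet V T →
  ∀ {a b} → E G a b → a ∈ S → a ∉ T → (∀ v → v ∈ T → v ∉ S → v ≡ a ⊎ v ≡ b) → ⊥
¬move-along-edge G V V-independent V-parts {S} {T} (x , x∈V , _ , x↠S) (y , y∈V , y-distinct , y↠T)
  {a} {b} ab a∈S a∉T T-S⊆ab with proj₁ (x↠S a) a∈S
... | i , refl =
  V-independent i a b (x∈V i)
    (moved-token-stays-in-its-part V V-parts x∈V x↠S y∈V y-distinct y↠T i a∉T T-b⊆S) ab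
  where
  T-b⊆S : ∀ v → v ∈ T → v ≢ b → v ∈ S
  T-b⊆S v v∈T v≢b with v ∈? S
  ... | yes v∈S = v∈S
  ... | no  v∉S with T-S⊆ab v v∈T v∉S
  ...   | inj₁ refl = contradiction v∈T a∉T
  ...   | inj₂ v≡b  = contradiction v≡b v≢b

theorem3p2 : (n k : ℕ) → 1 ≤ k → k ≤ n ∸ 1 → (G : Graph n) → (V : Fin k → Subset n) →
    (∀ i → IsIndependent G (V i)) →
    (∀ i j → i ≢ j → Disjoint (V i) (V j) ⊎ V i ≡ V j) →
    IsIndependentInTokenGraph G k (ProductSet V)
-- The bounds on k only serve to make T_k(G) well defined.
theorem3p2 n k _ _ G V V-independent V-parts = has-size-k , independent
  where
  has-size-k : ∀ S → ProductSet V S → ∣ S ∣ ≡ k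
  has-size-k S (x , _ , x-distinct , x↠S) = distinct-enumeration-size k x x-distinct x↠S

  independent : ∀ S T → ProductSet V S → ProductSet V T → ¬ TokenAdj G S T
  independent S T P Q (a , b , ab , S∆T≡ab) with proj₂ (S∆T≡ab a) (inj₁ refl)
  ... | inj₁ (a∈S , a∉T) =
    ¬move-along-edge G V V-independent V-parts P Q ab a∈S a∉T
      (λ v v∈T v∉S → proj₁ (S∆T≡ab v) (inj₂ (v∉S , v∈T)))
  ... | inj₂ (a∉S , a∈T) =
    ¬move-along-edge G V V-independent V-parts Q P ab a∈T a∉S
      (λ v v∈S v∉T → proj₁ (S∆T≡ab v) (inj₁ (v∈S , v∉T)))
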